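{- Assume the univalence axiom. Then homotopy-initial small bipointed types are unique up to a contractible type of paths: the type $(\Pi A:\mathsf{Bip})(\Pi B:\mathsf{Bip})\big(\mathsf{ishinit}(A)\times\mathsf{ishinit}(B)\to\mathsf{iscontr}(\mathsf{Id}_{\mathsf{Bip}}(A,B))\big)$ is inhabited.
   Context: Work in the intensional Martin-Löf type theory $\mathcal{H}$ with $\Sigma$-types, $\Pi$-types (with judgemental $\eta$), identity types, a universe $\mathsf{U}$ closed under $\Sigma,\Pi,\mathsf{Id}$, and function extensionality; no UIP. $\mathsf{iscontr}(X):=(\Sigma x:X)(\Pi y:X)\mathsf{Id}(x,y)$. Univalence axiom: for all $X,Y:\mathsf{U}$ the canonical map from $\mathsf{Id}_{\mathsf{U}}(X,Y)$ to the type of equivalences $X\to Y$ (functions with contractible homotopy fibers) is an equivalence. $\mathsf{Bip}:=(\Sigma A:\mathsf{U})(A\times A)$, elements $(A,a_0,a_1)$. $\mathsf{Bip}(A,B):=(\Sigma f:A\to B)(\mathsf{Id}(fa_0,b_0)\times\mathsf{Id}(fa_1,b_1))$; $\mathsf{ishinit}(A):=(\Pi B:\mathsf{Bip})\mathsf{iscontr}(\mathsf{Bip}(A,B))$. -}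

{-# OPTIONS --without-K #-}
module Defs where

open import Agda.Primitive using (Level)
open import Data.Product using (Σ; Σ-syntax; _×_; _,_; proj₁; proj₂)
open import Relation.Binary.PropositionalEquality using (_≡_; refl)

-- The universe U of the paper is Agda's Set (= Set₀).

iscontr : ∀ {ℓ} (X : Set ℓ) → Set ℓ
iscontr X = Σ[ x ∈ X ] ((y : X) → x ≡ y)

hfiber : ∀ {ℓ ℓ'} {X : Set ℓ} {Y : Set ℓ'} (f : X → Y) (y : Y) → Set (Agda.Primitive._⊔_ ℓ ℓ')
hfiber {X = X} f y = Σ[ x ∈ X ] (f x ≡ y)

isequiv : ∀ {ℓ ℓ'} {X : Set ℓ} {Y : Set ℓ'} (f : X → Y) → Set (Agda.Primitive._⊔_ ℓ ℓ')
isequiv {Y = Y} f = (y : Y) → iscontr (hfiber f y)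

Eqv : (X Y : Set) → Set
Eqv X Y = Σ[ f ∈ (X → Y) ] isequiv f

idIsEquiv : (X : Set) → isequiv (λ (x : X) → x)
idIsEquiv X y = (y , refl) , λ { (x , refl) → refl }

idtoeqv : {X Y : Set} → X ≡ Y → Eqv X Y
idtoeqv {X} refl = (λ x → x) , idIsEquiv X

Univalence : Set₁
Univalence = (X Y : Set) → isequiv (idtoeqv {X} {Y})

-- Function extensionality (part of the ambient theory H)
FunExt : Set₁
FunExt = {A : Set} {B : A → Set} {f g : (x : A) → B x} → ((x : A) → f x ≡ g x) → f ≡ g

Bip : Set₁
Bip = Σ[ A ∈ Set ] (A × A)

BipHom : Bip → Bip → Set
BipHom (A , a₀ , a₁) (B , b₀ , b₁) = Σ[ f ∈ (A → B) ] ((f a₀ ≡ b₀) × (f a₁ ≡ b₁))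

ishinit : Bip → Set₁
ishinit A = (B : Bip) → iscontr (BipHom A B)

{-# OPTIONS --without-K #-}
-- Between h-initial bipointed types there is exactly one morphism in each direction;
-- both composites are endomorphisms of an h-initial object, hence identities, so the
-- unique morphism A → B is an equivalence and the type of bipointed equivalences is
-- contractible. Univalence makes A ≡ B a retract of that type.
module Submission where

open import Defs
open import Data.Product using (Σ; _×_; Σ-syntax; _,_; proj₁; proj₂)
open import Function.Bundles using (mk↔ₛ′)
open import Function.Properties.Inverse.HalfAdjointEquivalence using (_≃_; ↔⇒≃)
open import Relation.Binary.PropositionalEquality
  using (_≡_; refl; sym; trans; cong; trans-symˡ)

≃⇒isequiv : ∀ {a b} {X : Set a} {Y : Set b} (e : X ≃ Y) → isequiv (_≃_.to e)
≃⇒isequiv e y =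
  (from y , right-inverse-of y) ,
  λ { (x , refl) → fibre-path (left-inverse-of x) (right-inverse-of (to x)) (left-right x) }
  where
  open _≃_ e
  fibre-path : ∀ {x x′} (p : x′ ≡ x) (q : to x′ ≡ to x) → cong to p ≡ q
             → _≡_ {A = hfiber to (to x)} (x′ , q) (x , refl)
  fibre-path refl refl refl = refl

qinv⇒isequiv : ∀ {a b} {X : Set a} {Y : Set b} (f : X → Y) (g : Y → X)
             → (∀ x → g (f x) ≡ x) → (∀ y → f (g y) ≡ y) → isequiv f
qinv⇒isequiv f g gf fg = ≃⇒isequiv (↔⇒≃ (mk↔ₛ′ f g fg gf))

iscontr⇒isProp : ∀ {a} {X : Set a} → iscontr X → (x y : X) → x ≡ y
iscontr⇒isProp (c , h) x y = trans (sym (h x)) (h y)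

iscontr-paths : ∀ {a} {X : Set a} → iscontr X → {x y : X} (p q : x ≡ y) → p ≡ q
iscontr-paths {X = X} c p q = trans (via-centre p) (sym (via-centre q))
  where
  via-centre : {x y : X} (p : x ≡ y) → p ≡ iscontr⇒isProp c x y
  via-centre {x} refl = sym (trans-symˡ (proj₂ c x))

iscontr-isProp : FunExt → {X : Set} (c c′ : iscontr X) → c ≡ c′
iscontr-isProp fe (x , h) (x′ , h′) = lemma (h x′) h′
  where
  lemma : ∀ {y} (p : x ≡ y) (h″ : ∀ z → y ≡ z) → (x , h) ≡ (y , h″)
  lemma refl h″ = cong (x ,_) (fe λ z → iscontr-paths (x , h) (h z) (h″ z))

isequiv-isProp : FunExt → {X Y : Set} (f : X → Y) (e e′ : isequiv f) → e ≡ e′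
isequiv-isProp fe f e e′ = fe λ y → iscontr-isProp fe (e y) (e′ y)

retract-iscontr : ∀ {a b} {X : Set a} {Y : Set b} (s : X → Y) (r : Y → X)
                → (∀ x → r (s x) ≡ x) → iscontr Y → iscontr X
retract-iscontr s r rs (c , h) = r c , λ x → trans (cong r (h (s x))) (rs x)

Σ-iscontr : ∀ {a b} {X : Set a} {P : X → Set b} (c : iscontr X)
          → (∀ x (u v : P x) → u ≡ v) → P (proj₁ c) → iscontr (Σ X P)
Σ-iscontr {P = P} (c , h) P-isProp u = (c , u) , λ { (x , v) → lemma (h x) v }
  where
  lemma : ∀ {x} (p : c ≡ x) (v : P x) → (c , u) ≡ (x , v)
  lemma refl v = cong (c ,_) (P-isProp c u v)

idBipHom : (A : Bip) → BipHom A A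
idBipHom (A , a₀ , a₁) = (λ x → x) , refl , refl

_∘Bip_ : {A B C : Bip} → BipHom B C → BipHom A B → BipHom A C
_∘Bip_ {A , a₀ , a₁} {B , b₀ , b₁} {C , c₀ , c₁} (g , g₀ , g₁) (f , f₀ , f₁) =
  (λ x → g (f x)) , trans (cong g f₀) g₀ , trans (cong g f₁) g₁

BipEquiv : Bip → Bip → Set
BipEquiv A B = Σ[ h ∈ BipHom A B ] isequiv (proj₁ h)

ishinit-endo≡id : {A : Bip} → ishinit A → (h : BipHom A A) → h ≡ idBipHom A
ishinit-endo≡id {A} init h = iscontr⇒isProp (init A) h (idBipHom A)

ishinit-hom-isequiv : {A B : Bip} → ishinit A → ishinit B → (h : BipHom A B) → isequiv (proj₁ h)
ishinit-hom-isequiv {A} {B} initA initB h =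
  qinv⇒isequiv (proj₁ h) (proj₁ k)
    (λ x → cong (λ e → proj₁ e x) (ishinit-endo≡id initA (k ∘Bip h)))
    (λ y → cong (λ e → proj₁ e y) (ishinit-endo≡id initB (h ∘Bip k)))
  where
  k : BipHom B A
  k = proj₁ (initB A)

ishinit-BipEquiv-iscontr : FunExt → {A B : Bip} → ishinit A → ishinit B → iscontr (BipEquiv A B)
ishinit-BipEquiv-iscontr fe {A} {B} initA initB =
  Σ-iscontr (initA B) (λ h → isequiv-isProp fe (proj₁ h))
    (ishinit-hom-isequiv initA initB (proj₁ (initA B)))

idtoBipEquiv : {A B : Bip} → A ≡ B → BipEquiv A B
idtoBipEquiv {X , a₀ , a₁} refl = idBipHom (X , a₀ , a₁) , idIsEquiv X

Bip-path : {X Z : Set} {a₀ a₁ : X} {b₀ b₁ : Z} (P : X ≡ Z)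
         → proj₁ (idtoeqv P) a₀ ≡ b₀ → proj₁ (idtoeqv P) a₁ ≡ b₁
         → _≡_ {A = Bip} (X , a₀ , a₁) (Z , b₀ , b₁)
Bip-path refl refl refl = refl

Bip-path-over : {X Z : Set} {a₀ a₁ : X} {b₀ b₁ : Z} (E : Eqv X Z)
              → proj₁ E a₀ ≡ b₀ → proj₁ E a₁ ≡ b₁
              → hfiber (idtoeqv {X} {Z}) E → _≡_ {A = Bip} (X , a₀ , a₁) (Z , b₀ , b₁)
Bip-path-over E p₀ p₁ (P , w) =
  Bip-path P (trans (cong (λ E′ → proj₁ E′ _) w) p₀) (trans (cong (λ E′ → proj₁ E′ _) w) p₁)

module _ (ua : Univalence) where

  bipEquivToId : {A B : Bip} → BipEquiv A B → A ≡ B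
  bipEquivToId {X , _} {Z , _} ((f , p₀ , p₁) , e) =
    Bip-path-over (f , e) p₀ p₁ (proj₁ (ua X Z (f , e)))

  bipEquivToId-idtoBipEquiv : {A B : Bip} (p : A ≡ B) → bipEquivToId (idtoBipEquiv p) ≡ p
  bipEquivToId-idtoBipEquiv {X , _} refl =
    cong (Bip-path-over (idtoeqv refl) refl refl) (proj₂ (ua X X (idtoeqv refl)) (refl , refl))

corollary3p15 : FunExt → Univalence → (A B : Bip) → ishinit A × ishinit B → iscontr (A ≡ B)
corollary3p15 fe ua A B (initA , initB) =
  retract-iscontr idtoBipEquiv (bipEquivToId ua) (bipEquivToId-idtoBipEquiv ua)
    (ishinit-BipEquiv-iscontr fe initA initB)
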